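{- For every $n\ge1$ and partition $\lambda\subseteq\delta_n$, the polytope $\mathcal{P}_\lambda(n)$ is a face of $\mathcal{A}(n)$ of dimension $\binom{n}{2}-|\lambda|$. In particular, $\mathcal{P}_\varnothing(n)=\mathcal{ASMCRY}(n)$ is a face of $\mathcal{A}(n)$ of dimension $\binom n2$.
   Context: $\mathcal{A}(n)$ is the set of real $n\times n$ matrices $(a_{ij})$ with $0\le\sum_{i=1}^{i'}a_{ij}\le1$ for all $1\le i',j\le n$, $0\le\sum_{j=1}^{j'}a_{ij}\le1$ for all $1\le j',i\le n$, and all full row and column sums equal to $1$ (the alternating sign matrix polytope). $\delta_n=(n-1,\dots,1)$; a partition $\lambda=(\lambda_1,\dots,\lambda_k)\subseteq\delta_n$ (i.e. $\lambda_i\le n-i$) is identified with the set of positions $\{(i,j):1\le i\le k,\ n-\lambda_i+1\le j\le n\}$, and $|\lambda|=\sum_i\lambda_i$. $\mathcal{P}_\lambda(n)=\{(a_{ij})\in\mathcal{A}(n):a_{ij}=0 \text{ whenever } i-j\ge2 \text{ and whenever }(i,j)\in\lambda\}$, and $\mathcal{ASMCRY}(n)=\mathcal{P}_\varnothing(n)$.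
   Formalization: The matrices in $\mathcal{A}(n)$ and $\mathcal{P}_\lambda(n)$ have rational rather than real entries, as do the supporting hyperplane and the affinely independent points witnessing the dimension. -}

module Defs where

open import Data.Nat as ℕ using (ℕ; zero; suc)
open import Data.Fin using (Fin; toℕ) renaming (zero to fz; suc to fs)
open import Data.List using (List; []; _∷_; length)
open import Data.Rational as ℚ using (ℚ; 0ℚ; 1ℚ; _+_; _*_; _-_)
open import Data.Product using (Σ; _×_; ∃)
open import Data.Empty using (⊥)
open import Data.Unit using (⊤)
open import Relation.Nullary using (¬_)
open import Relation.Binary.PropositionalEquality using (_≡_)
open import Function.Bundles using (_⇔_)

-- Real n×n matrices are represented by rational ones.
Mat : ℕ → Set
Mat n = Fin n → Fin n → ℚ

-- psum f m = f 0 + … + f (m-1)  (sum of the first m entries, truncated at n)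
psum : ∀ {n} → (Fin n → ℚ) → ℕ → ℚ
psum {zero}  f m       = 0ℚ
psum {suc n} f zero    = 0ℚ
psum {suc n} f (suc m) = f fz + psum (λ i → f (fs i)) m

sumF : ∀ {n} → (Fin n → ℚ) → ℚ
sumF {n} f = psum f n

-- The alternating sign matrix polytope 𝒜(n) (rows/columns indexed 0..n-1).
InASMPolytope : (n : ℕ) → Mat n → Set
InASMPolytope n a =
    (∀ (j : Fin n) (m : ℕ) → 1 ℕ.≤ m → m ℕ.≤ n →
        (0ℚ ℚ.≤ psum (λ i → a i j) m) × (psum (λ i → a i j) m ℚ.≤ 1ℚ))
  × (∀ (i : Fin n) (m : ℕ) → 1 ℕ.≤ m → m ℕ.≤ n →
        (0ℚ ℚ.≤ psum (λ j → a i j) m) × (psum (λ j → a i j) m ℚ.≤ 1ℚ))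
  × (∀ (j : Fin n) → sumF (λ i → a i j) ≡ 1ℚ)
  × (∀ (i : Fin n) → sumF (λ j → a i j) ≡ 1ℚ)

Decreasing : List ℕ → Set
Decreasing []           = ⊤
Decreasing (x ∷ [])     = ⊤
Decreasing (x ∷ y ∷ xs) = (y ℕ.≤ x) × Decreasing (y ∷ xs)

AllPositive : List ℕ → Set
AllPositive []       = ⊤
AllPositive (x ∷ xs) = (1 ℕ.≤ x) × AllPositive xs

IsPartition : List ℕ → Set
IsPartition l = Decreasing l × AllPositive l

-- part l i = λ_{i+1} (0-based), 0 beyond the length
part : List ℕ → ℕ → ℕ
part []       _       = 0
part (x ∷ xs) zero    = x
part (x ∷ xs) (suc i) = part xs i

size : List ℕ → ℕ
size []       = 0
size (x ∷ xs) = x ℕ.+ size xs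

-- λ ⊆ δ_n :  λ_i ≤ n - i  for 1 ≤ i ≤ length (1-based), i.e. part i + i + 1 ≤ n (0-based)
SubStaircase : ℕ → List ℕ → Set
SubStaircase n l = ∀ (i : ℕ) → i ℕ.< length l → part l i ℕ.+ suc i ℕ.≤ n

-- (i,j) ∈ λ (0-based): i < length λ and n - λ_i ≤ j, i.e. n ≤ j + λ_i
-- (for i ≥ length λ, part = 0 and the condition is automatically false)
InShape : (n : ℕ) → List ℕ → Fin n → Fin n → Set
InShape n l i j = n ℕ.≤ toℕ j ℕ.+ part l (toℕ i)

InPλ : (n : ℕ) → List ℕ → Mat n → Set
InPλ n l a = InASMPolytope n a
  × (∀ (i j : Fin n) → suc (suc (toℕ j)) ℕ.≤ toℕ i → a i j ≡ 0ℚ)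
  × (∀ (i j : Fin n) → InShape n l i j → a i j ≡ 0ℚ)

InASMCRY : (n : ℕ) → Mat n → Set
InASMCRY n = InPλ n []

dot : ∀ {n} → Mat n → Mat n → ℚ
dot w x = sumF (λ i → sumF (λ j → w i j * x i j))

-- F is a face of P: F = P ∩ H for a supporting hyperplane H = {x : w·x = b}
-- with w·x ≤ b on P (w = 0, b = 0 gives P itself).
IsFace : ∀ {n} → (Mat n → Set) → (Mat n → Set) → Set
IsFace {n} F P = Σ (Mat n) λ w → Σ ℚ λ b →
    (∀ x → P x → dot w x ℚ.≤ b)
  × (∀ x → F x ⇔ (P x × (dot w x ≡ b)))

AffinelyIndependent : ∀ {n k} → (Fin k → Mat n) → Set
AffinelyIndependent {n} {k} p = ∀ (c : Fin k → ℚ) →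
    sumF c ≡ 0ℚ →
    (∀ (i j : Fin n) → sumF (λ t → c t * p t i j) ≡ 0ℚ) →
    ∀ t → c t ≡ 0ℚ

HasDimension : ∀ {n} → (Mat n → Set) → ℕ → Set
HasDimension {n} S d =
    (Σ (Fin (suc d) → Mat n) λ p → (∀ t → S (p t)) × AffinelyIndependent p)
  × ¬ (Σ (Fin (suc (suc d)) → Mat n) λ p → (∀ t → S (p t)) × AffinelyIndependent p)

{-# OPTIONS --safe #-}
module Submission where

-- Every row and column of a matrix in 𝒜(n) has partial sums in [0, 1] and total 1, so all
-- of its suffix sums are nonnegative. For such a vector f the weighted sum Σⱼ (j ∸ k) fⱼ is
-- the sum of its suffix sums starting beyond k; it is therefore nonnegative, and it vanishes
-- exactly when f vanishes beyond k. Adding these weighted sums over the columns (k = j + 1)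
-- and the rows (k = n − 1 − λᵢ) gives a linear functional that is nonnegative on 𝒜(n) and
-- vanishes exactly on 𝒫_λ(n), so 𝒫_λ(n) is a face.
--
-- Call a cell (r, c) free if r < c and (r, c) ∉ λ; there are C(n,2) − |λ| of them. The identity
-- and, for every free cell (r, c), the permutation matrix of the cycle r ↦ c ↦ c − 1 ↦ ⋯ ↦ r + 1 ↦ r
-- lie in 𝒫_λ(n), and the cycle matrix of (r, c) is the only one of them that is nonzero at
-- (r, c), so they are affinely independent. Conversely, the free entries of any C(n,2) − |λ| + 2
-- points of 𝒫_λ(n) are affinely dependent, and the same combination of the whole matrices is
-- zero off the diagonal and subdiagonal and has zero row and column sums, which forces it to vanish.

open import Defs
open import Data.Nat as ℕ using (ℕ; zero; suc; _≤_; _<_; _∸_; z≤n; s≤s)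
import Data.Nat.Properties as ℕP
open import Data.Nat.Combinatorics using (_C_; nC1≡n; nCk+nC[k+1]≡[n+1]C[k+1])
open import Data.Nat.Tactic.RingSolver using (solve-∀)
open import Data.Empty using (⊥-elim)
open import Data.Unit using (⊤; tt)
open import Data.Fin using (Fin; zero; suc; toℕ; fromℕ<; punchIn; splitAt; _↑ˡ_; _↑ʳ_)
import Data.Fin.Properties as FinP
open import Data.List using (List; []; _∷_; length)
open import Data.Product as Product using (Σ; _×_; _,_; proj₁; proj₂)
open import Data.Product.Properties using (×-≡,≡→≡)
open import Data.Sum using (inj₁; inj₂; [_,_]′)
open import Data.Rational as ℚ using (ℚ; 0ℚ; 1ℚ; _+_; _*_; _-_; -_; 1/_)
import Data.Rational.Properties as ℚP
open import Data.Rational.Solver using (module +-*-Solver)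
open import Data.Vec.Functional using (tail; insertAt; removeAt)
open import Data.Vec.Functional.Properties using (insertAt-lookup; insertAt-punchIn)
open import Function using (_∘_; id)
open import Function.Bundles using (mk⇔)
open import Relation.Binary.Definitions using (tri<; tri≈; tri>)
open import Relation.Binary.PropositionalEquality
open import Relation.Nullary using (¬_; Dec; yes; no)
open import Algebra.Bundles using (Ring)
open import Algebra.Properties.CommutativeMonoid.Sum ℚP.+-0-commutativeMonoid
  using (sum; sum-cong-≗; sum-replicate-zero; ∑-distrib-+; ∑-comm; sum-remove)
open import Algebra.Properties.Semiring.Sum (Ring.semiring ℚP.+-*-ring) using (*-distribˡ-sum; *-distribʳ-sum)
import Algebra.Properties.CommutativeMonoid.Sum ℕP.+-0-commutativeMonoid as ℕ∑

0≤1 : 0ℚ ℚ.≤ 1ℚ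
0≤1 = ℚP.nonNegative⁻¹ 1ℚ

sumF≡sum : ∀ {n} (f : Fin n → ℚ) → sumF f ≡ sum f
sumF≡sum {zero}  f = refl
sumF≡sum {suc n} f = cong (f zero +_) (sumF≡sum (tail f))

sum-zero : ∀ {n} {f : Fin n → ℚ} → (∀ i → f i ≡ 0ℚ) → sum f ≡ 0ℚ
sum-zero {n} f≗0 = trans (sum-cong-≗ f≗0) (sum-replicate-zero n)

sum-neg : ∀ {n} (f : Fin n → ℚ) → sum (λ i → - f i) ≡ - sum f
sum-neg {zero}  f = refl
sum-neg {suc n} f = trans (cong (- f zero +_) (sum-neg (tail f)))
                          (sym (ℚP.neg-distrib-+ (f zero) (sum (tail f))))

sum-single : ∀ {n} (s : Fin (suc n)) (f : Fin (suc n) → ℚ) →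
             (∀ t → t ≢ s → f t ≡ 0ℚ) → sum f ≡ f s
sum-single s f f≗0 = begin
  sum f                        ≡⟨ sum-remove {i = s} f ⟩
  f s + sum (removeAt f s)     ≡⟨ cong (f s +_) (sum-zero (λ t → f≗0 (punchIn s t) (FinP.punchInᵢ≢i s t))) ⟩
  f s + 0ℚ                     ≡⟨ ℚP.+-identityʳ (f s) ⟩
  f s                          ∎
  where open ≡-Reasoning

sum-nonneg : ∀ {n} {f : Fin n → ℚ} → (∀ i → 0ℚ ℚ.≤ f i) → 0ℚ ℚ.≤ sum f
sum-nonneg {zero}  f≥0 = ℚP.≤-refl
sum-nonneg {suc n} f≥0 = ℚP.+-mono-≤ (f≥0 zero) (sum-nonneg (f≥0 ∘ suc))

a+b≡0⇒a≡0 : ∀ {a b} → b ≡ 0ℚ → a + b ≡ 0ℚ → a ≡ 0ℚ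
a+b≡0⇒a≡0 {a} b≡0 a+b≡0 = trans (sym (ℚP.+-identityʳ a)) (trans (cong (a +_) (sym b≡0)) a+b≡0)

a+b≡0⇒b≡0 : ∀ {a b} → a ≡ 0ℚ → a + b ≡ 0ℚ → b ≡ 0ℚ
a+b≡0⇒b≡0 {a} {b} a≡0 a+b≡0 = trans (sym (ℚP.+-identityˡ b)) (trans (cong (_+ b) (sym a≡0)) a+b≡0)

nonneg+nonneg≡0 : ∀ {a b} → 0ℚ ℚ.≤ a → 0ℚ ℚ.≤ b → a + b ≡ 0ℚ → a ≡ 0ℚ × b ≡ 0ℚ
nonneg+nonneg≡0 {a} {b} a≥0 b≥0 a+b≡0 = a≡0 , a+b≡0⇒b≡0 a≡0 a+b≡0
  where
  a≡0 : a ≡ 0ℚ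
  a≡0 = ℚP.≤-antisym (ℚP.≤-trans (ℚP.≤-reflexive (sym (ℚP.+-identityʳ a)))
                       (ℚP.≤-trans (ℚP.+-monoʳ-≤ a b≥0) (ℚP.≤-reflexive a+b≡0))) a≥0

sum-nonneg≡0 : ∀ {n} {f : Fin n → ℚ} → (∀ i → 0ℚ ℚ.≤ f i) → sum f ≡ 0ℚ → ∀ i → f i ≡ 0ℚ
sum-nonneg≡0 {suc n} f≥0 Σf≡0 zero    = proj₁ (nonneg+nonneg≡0 (f≥0 zero) (sum-nonneg (f≥0 ∘ suc)) Σf≡0)
sum-nonneg≡0 {suc n} f≥0 Σf≡0 (suc i) =
  sum-nonneg≡0 (f≥0 ∘ suc) (proj₂ (nonneg+nonneg≡0 (f≥0 zero) (sum-nonneg (f≥0 ∘ suc)) Σf≡0)) i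

dot≡sum : ∀ {n} (w x : Mat n) → dot w x ≡ sum (λ i → sum (λ j → w i j * x i j))
dot≡sum w x = trans (sumF≡sum (λ i → sumF (λ j → w i j * x i j)))
                    (sum-cong-≗ (λ i → sumF≡sum (λ j → w i j * x i j)))

sum-combination : ∀ {m n} (c : Fin m → ℚ) (u : Fin m → Fin n → ℚ) → (∀ t → sumF (u t) ≡ 1ℚ) →
                  sum (λ j → sum (λ t → c t * u t j)) ≡ sum (λ t → c t * 1ℚ)
sum-combination c u Σu≡1 = begin
  sum (λ j → sum (λ t → c t * u t j))  ≡⟨ ∑-comm (λ j t → c t * u t j) ⟩
  sum (λ t → sum (λ j → c t * u t j))  ≡⟨ sum-cong-≗ (λ t → *-distribˡ-sum (c t) (u t)) ⟨
  sum (λ t → c t * sum (u t))          ≡⟨ sum-cong-≗ (λ t → cong (c t *_) (Σu≡1′ t)) ⟩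
  sum (λ t → c t * 1ℚ)                 ∎
  where
  open ≡-Reasoning
  Σu≡1′ : ∀ t → sum (u t) ≡ 1ℚ
  Σu≡1′ t = trans (sym (sumF≡sum (u t))) (Σu≡1 t)

LinearlyIndependent : ∀ {m k} → (Fin m → Fin k → ℚ) → Set
LinearlyIndependent {m} v = ∀ (c : Fin m → ℚ) → (∀ q → sum (λ t → c t * v t q) ≡ 0ℚ) → ∀ t → c t ≡ 0ℚ

pivot : ∀ {m} (x : Fin (suc m) → ℚ) →
        Σ (Fin (suc m)) λ s → Σ (Fin m → ℚ) λ α → ∀ t → x (punchIn s t) ≡ α t * x s
pivot {m} x with FinP.all? (λ t → x t ℚP.≟ 0ℚ)
... | yes x≡0 = zero , (λ _ → 0ℚ) , λ t → trans (x≡0 (suc t)) (sym (ℚP.*-zeroˡ (x zero)))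
... | no  x≢0 with FinP.¬∀⟶∃¬ _ _ (λ t → x t ℚP.≟ 0ℚ) x≢0
...   | s , xs≢0 = s , (λ t → x (punchIn s t) * 1/ x s) , α-spec
  where
  instance
    xs-nonZero : ℚ.NonZero (x s)
    xs-nonZero = ℚ.≢-nonZero xs≢0
  α-spec : ∀ t → x (punchIn s t) ≡ x (punchIn s t) * 1/ x s * x s
  α-spec t = sym (begin
    x (punchIn s t) * 1/ x s * x s    ≡⟨ ℚP.*-assoc (x (punchIn s t)) (1/ x s) (x s) ⟩
    x (punchIn s t) * (1/ x s * x s)  ≡⟨ cong (x (punchIn s t) *_) (ℚP.*-inverseˡ (x s)) ⟩
    x (punchIn s t) * 1ℚ              ≡⟨ ℚP.*-identityʳ _ ⟩
    x (punchIn s t)                   ∎)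
    where open ≡-Reasoning

eliminate : ∀ {m k} (v : Fin (suc m) → Fin (suc k) → ℚ) (s : Fin (suc m)) (α : Fin m → ℚ) →
            (∀ t → v (punchIn s t) zero ≡ α t * v s zero) →
            LinearlyIndependent v →
            LinearlyIndependent (λ t q → v (punchIn s t) (suc q) - α t * v s (suc q))
eliminate {m} v s α pivotal indep c dep t =
  trans (sym (insertAt-punchIn c s a t)) (indep (insertAt c s a) dep′ (punchIn s t))
  where
  open ≡-Reasoning
  open +-*-Solver
  a : ℚ
  a = - sum (λ t → c t * α t)
  c′ : Fin (suc m) → ℚ
  c′ = insertAt c s a
  reduce : ∀ q → sum (λ t → c′ t * v t q) ≡ sum (λ t → c t * (v (punchIn s t) q - α t * v s q))
  reduce q = begin
    sum (λ t → c′ t * v t q)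
      ≡⟨ sum-remove {i = s} (λ t → c′ t * v t q) ⟩
    c′ s * v s q + sum (λ t → c′ (punchIn s t) * v (punchIn s t) q)
      ≡⟨ cong₂ _+_ (cong (_* v s q) (insertAt-lookup c s a))
                   (sum-cong-≗ (λ t → cong (_* v (punchIn s t) q) (insertAt-punchIn c s a t))) ⟩
    a * v s q + sum (λ t → c t * v (punchIn s t) q)
      ≡⟨ cong (_+ sum (λ t → c t * v (punchIn s t) q)) (begin
           a * v s q                               ≡⟨ ℚP.neg-distribˡ-* (sum (λ t → c t * α t)) (v s q) ⟨
           - (sum (λ t → c t * α t) * v s q)       ≡⟨ cong -_ (*-distribʳ-sum (v s q) (λ t → c t * α t)) ⟩
           - sum (λ t → c t * α t * v s q)         ≡⟨ sum-neg (λ t → c t * α t * v s q) ⟨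
           sum (λ t → - (c t * α t * v s q))       ∎) ⟩
    sum (λ t → - (c t * α t * v s q)) + sum (λ t → c t * v (punchIn s t) q)
      ≡⟨ ∑-distrib-+ (λ t → - (c t * α t * v s q)) (λ t → c t * v (punchIn s t) q) ⟨
    sum (λ t → - (c t * α t * v s q) + c t * v (punchIn s t) q)
      ≡⟨ sum-cong-≗ (λ t → solve 4 (λ c α x y → :- (c :* α :* x) :+ c :* y := c :* (y :- α :* x))
                                   refl (c t) (α t) (v s q) (v (punchIn s t) q)) ⟩
    sum (λ t → c t * (v (punchIn s t) q - α t * v s q)) ∎
  dep′ : ∀ q → sum (λ t → c′ t * v t q) ≡ 0ℚ
  dep′ zero    = trans (reduce zero) (sum-zero λ t → begin
    c t * (v (punchIn s t) zero - α t * v s zero)  ≡⟨ cong (λ y → c t * (y - α t * v s zero)) (pivotal t) ⟩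
    c t * (α t * v s zero - α t * v s zero)        ≡⟨ cong (c t *_) (ℚP.+-inverseʳ (α t * v s zero)) ⟩
    c t * 0ℚ                                       ≡⟨ ℚP.*-zeroʳ (c t) ⟩
    0ℚ                                             ∎)
  dep′ (suc q) = trans (reduce (suc q)) (dep q)

¬linearlyIndependent : ∀ k (v : Fin (suc k) → Fin k → ℚ) → ¬ LinearlyIndependent v
¬linearlyIndependent zero    v indep with indep (λ _ → 1ℚ) (λ ()) zero
... | ()
¬linearlyIndependent (suc k) v indep with pivot (λ t → v t zero)
... | s , α , pivotal =
  ¬linearlyIndependent k (λ t q → v (punchIn s t) (suc q) - α t * v s (suc q)) (eliminate v s α pivotal indep)

-- Vectors with nonnegative suffix sums

fromℕ : ℕ → ℚ
fromℕ zero    = 0ℚ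
fromℕ (suc m) = fromℕ m + 1ℚ

moment : ∀ {n} → ℕ → (Fin n → ℚ) → ℚ
moment k f = sum (λ j → fromℕ (toℕ j ∸ k) * f j)

SuffixSumsNonneg : ∀ {n} → (Fin n → ℚ) → Set
SuffixSumsNonneg {zero}  f = ⊤
SuffixSumsNonneg {suc n} f = 0ℚ ℚ.≤ sum f × SuffixSumsNonneg (tail f)

+-cancelˡ-≤ : ∀ a {x y} → a + x ℚ.≤ a + y → x ℚ.≤ y
+-cancelˡ-≤ a {x} {y} a+x≤a+y = subst₂ ℚ._≤_ (cancel x) (cancel y) (ℚP.+-monoʳ-≤ (- a) a+x≤a+y)
  where
  cancel : ∀ z → - a + (a + z) ≡ z
  cancel z = trans (sym (ℚP.+-assoc (- a) a z))
                   (trans (cong (_+ z) (ℚP.+-inverseˡ a)) (ℚP.+-identityˡ z))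

prefix≤sum⇒SuffixSumsNonneg : ∀ {n} (f : Fin n → ℚ) →
                              (∀ m → m ≤ n → psum f m ℚ.≤ sum f) → SuffixSumsNonneg f
prefix≤sum⇒SuffixSumsNonneg {zero}  f prefix≤ = tt
prefix≤sum⇒SuffixSumsNonneg {suc n} f prefix≤ =
  prefix≤ 0 z≤n ,
  prefix≤sum⇒SuffixSumsNonneg (tail f) (λ m m≤n → +-cancelˡ-≤ (f zero) (prefix≤ (suc m) (s≤s m≤n)))

psum-empty : ∀ {n} (f : Fin n → ℚ) → psum f 0 ≡ 0ℚ
psum-empty {zero}  f = refl
psum-empty {suc n} f = refl

bounded-prefixes⇒SuffixSumsNonneg : ∀ {n} (f : Fin n → ℚ) →
  (∀ m → 1 ≤ m → m ≤ n → psum f m ℚ.≤ 1ℚ) → sumF f ≡ 1ℚ → SuffixSumsNonneg f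
bounded-prefixes⇒SuffixSumsNonneg {n} f prefix≤1 Σf≡1 = prefix≤sum⇒SuffixSumsNonneg f prefix≤sum
  where
  Σf≡1′ : sum f ≡ 1ℚ
  Σf≡1′ = trans (sym (sumF≡sum f)) Σf≡1
  prefix≤sum : ∀ m → m ≤ n → psum f m ℚ.≤ sum f
  prefix≤sum zero    _   = subst₂ ℚ._≤_ (sym (psum-empty f)) (sym Σf≡1′) 0≤1
  prefix≤sum (suc m) m≤n = subst (psum f (suc m) ℚ.≤_) (sym Σf≡1′) (prefix≤1 (suc m) (s≤s z≤n) m≤n)

ASM-column-SuffixSumsNonneg : ∀ {n} {x : Mat n} → InASMPolytope n x →
                              ∀ j → SuffixSumsNonneg (λ i → x i j)
ASM-column-SuffixSumsNonneg (colPrefix , _ , colSum , _) j =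
  bounded-prefixes⇒SuffixSumsNonneg _ (λ m 1≤m m≤n → proj₂ (colPrefix j m 1≤m m≤n)) (colSum j)

ASM-row-SuffixSumsNonneg : ∀ {n} {x : Mat n} → InASMPolytope n x →
                           ∀ i → SuffixSumsNonneg (λ j → x i j)
ASM-row-SuffixSumsNonneg (_ , rowPrefix , _ , rowSum) i =
  bounded-prefixes⇒SuffixSumsNonneg _ (λ m 1≤m m≤n → proj₂ (rowPrefix i m 1≤m m≤n)) (rowSum i)

0*x+y≡y : ∀ x y → 0ℚ * x + y ≡ y
0*x+y≡y x y = trans (cong (_+ y) (ℚP.*-zeroˡ x)) (ℚP.+-identityˡ y)

moment-suc : ∀ {n} k (f : Fin (suc n) → ℚ) → moment (suc k) f ≡ moment k (tail f)
moment-suc k f = 0*x+y≡y (f zero) (moment k (tail f))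

moment-zero : ∀ {n} (f : Fin (suc n) → ℚ) → moment 0 f ≡ moment 0 (tail f) + sum (tail f)
moment-zero f = begin
  0ℚ * f zero + sum (λ j → (fromℕ (toℕ j) + 1ℚ) * f (suc j))
    ≡⟨ 0*x+y≡y (f zero) _ ⟩
  sum (λ j → (fromℕ (toℕ j) + 1ℚ) * f (suc j))
    ≡⟨ sum-cong-≗ (λ j → trans (ℚP.*-distribʳ-+ (f (suc j)) (fromℕ (toℕ j)) 1ℚ)
                               (cong (fromℕ (toℕ j) * f (suc j) +_) (ℚP.*-identityˡ (f (suc j))))) ⟩
  sum (λ j → fromℕ (toℕ j) * f (suc j) + f (suc j))
    ≡⟨ ∑-distrib-+ (λ j → fromℕ (toℕ j) * f (suc j)) (tail f) ⟩
  moment 0 (tail f) + sum (tail f) ∎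
  where open ≡-Reasoning

SuffixSumsNonneg⇒sum-nonneg : ∀ {n} (f : Fin n → ℚ) → SuffixSumsNonneg f → 0ℚ ℚ.≤ sum f
SuffixSumsNonneg⇒sum-nonneg {zero}  f _          = ℚP.≤-refl
SuffixSumsNonneg⇒sum-nonneg {suc n} f (Σf≥0 , _) = Σf≥0

moment-nonneg : ∀ {n} k (f : Fin n → ℚ) → SuffixSumsNonneg f → 0ℚ ℚ.≤ moment k f
moment-nonneg {zero}  k       f _            = ℚP.≤-refl
moment-nonneg {suc n} (suc k) f (_ , tail≥0) =
  subst (0ℚ ℚ.≤_) (sym (moment-suc k f)) (moment-nonneg k (tail f) tail≥0)
moment-nonneg {suc n} zero    f (_ , tail≥0) =
  subst (0ℚ ℚ.≤_) (sym (moment-zero f))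
    (ℚP.+-mono-≤ (moment-nonneg 0 (tail f) tail≥0) (SuffixSumsNonneg⇒sum-nonneg (tail f) tail≥0))

moment≡0⇒ : ∀ {n} k (f : Fin n → ℚ) → SuffixSumsNonneg f → moment k f ≡ 0ℚ →
            ∀ j → k < toℕ j → f j ≡ 0ℚ
moment≡0⇒ {suc n} (suc k) f (_ , tail≥0) μ≡0 (suc j) (s≤s k<j) =
  moment≡0⇒ k (tail f) tail≥0 (trans (sym (moment-suc k f)) μ≡0) j k<j
moment≡0⇒ {suc n} zero    f (_ , tail≥0) μ≡0 (suc j) _ = tail≡0 j
  where
  μ≡0×Σ≡0 : moment 0 (tail f) ≡ 0ℚ × sum (tail f) ≡ 0ℚ
  μ≡0×Σ≡0 = nonneg+nonneg≡0 (moment-nonneg 0 (tail f) tail≥0) (SuffixSumsNonneg⇒sum-nonneg (tail f) tail≥0)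
                            (trans (sym (moment-zero f)) μ≡0)
  tail≡0-beyond-head : ∀ j → 0 < toℕ j → tail f j ≡ 0ℚ
  tail≡0-beyond-head = moment≡0⇒ 0 (tail f) tail≥0 (proj₁ μ≡0×Σ≡0)
  tail≡0 : ∀ j → tail f j ≡ 0ℚ
  tail≡0 zero    = a+b≡0⇒a≡0 (sum-zero (λ j → tail≡0-beyond-head (suc j) (s≤s z≤n))) (proj₂ μ≡0×Σ≡0)
  tail≡0 (suc j) = tail≡0-beyond-head (suc j) (s≤s z≤n)

moment≡0⇐ : ∀ {n} k (f : Fin n → ℚ) → (∀ j → k < toℕ j → f j ≡ 0ℚ) → moment k f ≡ 0ℚ
moment≡0⇐ k f f≡0 = sum-zero term≡0
  where
  term≡0 : ∀ j → fromℕ (toℕ j ∸ k) * f j ≡ 0ℚ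
  term≡0 j with k ℕP.<? toℕ j
  ... | yes k<j = trans (cong (fromℕ (toℕ j ∸ k) *_) (f≡0 j k<j)) (ℚP.*-zeroʳ (fromℕ (toℕ j ∸ k)))
  ... | no  k≮j = trans (cong (λ d → fromℕ d * f j) (ℕP.m≤n⇒m∸n≡0 (ℕP.≮⇒≥ k≮j))) (ℚP.*-zeroˡ (f j))

part-beyond : ∀ (l : List ℕ) i → length l ≤ i → part l i ≡ 0
part-beyond []      i       _         = refl
part-beyond (_ ∷ l) (suc i) (s≤s l≤i) = part-beyond l i l≤i

SubStaircase-bound : ∀ {n l} → SubStaircase n l → ∀ i → i < n → part l i ℕ.+ suc i ≤ n
SubStaircase-bound {n} {l} ss i i<n with i ℕP.<? length l
... | yes i<len = ss i i<len
... | no  i≮len rewrite part-beyond l i (ℕP.≮⇒≥ i≮len) = i<n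

SubStaircase⇒length≤ : ∀ {n l} → SubStaircase n l → length l ≤ n
SubStaircase⇒length≤ {n} {l} ss = bounded (length l) (λ i i<len → ℕP.m+n≤o⇒n≤o (part l i) (ss i i<len))
  where
  bounded : ∀ L → (∀ i → i < L → suc i ≤ n) → L ≤ n
  bounded zero    _       = z≤n
  bounded (suc L) suc-i≤n = suc-i≤n L ℕP.≤-refl

part<n : ∀ {n l} → SubStaircase n l → (i : Fin n) → part l (toℕ i) < n
part<n {l = l} ss i = ℕP.<-≤-trans (ℕP.m<m+n (part l (toℕ i)) (s≤s z≤n))
                                   (SubStaircase-bound {l = l} ss (toℕ i) (FinP.toℕ<n i))

diagonal+part<n : ∀ {n l} → SubStaircase n l → (i : Fin n) → toℕ i ℕ.+ part l (toℕ i) < n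
diagonal+part<n {n} {l} ss i =
  subst (_≤ n) (trans (ℕP.+-suc (part l (toℕ i)) (toℕ i)) (cong suc (ℕP.+-comm (part l (toℕ i)) (toℕ i))))
        (SubStaircase-bound {n} {l} ss (toℕ i) (FinP.toℕ<n i))

n∸[1+p]<j⇒n≤j+p : ∀ n p j → n ∸ suc p < j → n ≤ j ℕ.+ p
n∸[1+p]<j⇒n≤j+p n p j n∸[1+p]<j = begin
  n                        ≤⟨ ℕP.m≤n+m∸n n (suc p) ⟩
  suc p ℕ.+ (n ∸ suc p)    ≡⟨ ℕP.+-suc p (n ∸ suc p) ⟨
  p ℕ.+ suc (n ∸ suc p)    ≤⟨ ℕP.+-monoʳ-≤ p n∸[1+p]<j ⟩
  p ℕ.+ j                  ≡⟨ ℕP.+-comm p j ⟩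
  j ℕ.+ p                  ∎
  where open ℕP.≤-Reasoning

n≤j+p⇒n∸[1+p]<j : ∀ n p j → p < n → n ≤ j ℕ.+ p → n ∸ suc p < j
n≤j+p⇒n∸[1+p]<j n p j p<n n≤j+p = ℕP.+-cancelʳ-< p (n ∸ suc p) j (begin-strict
  n ∸ suc p ℕ.+ p        <⟨ ℕP.+-monoʳ-< (n ∸ suc p) (ℕP.n<1+n p) ⟩
  n ∸ suc p ℕ.+ suc p    ≡⟨ ℕP.m∸n+n≡m p<n ⟩
  n                      ≤⟨ n≤j+p ⟩
  j ℕ.+ p                ∎)
  where open ℕP.≤-Reasoning

k<n∸x⇒x+k<n : ∀ x {k n} → k < n ∸ x → x ℕ.+ k < n
k<n∸x⇒x+k<n zero    {n = n}     k<n   = k<n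
k<n∸x⇒x+k<n (suc x) {n = suc n} k<n∸x = s≤s (k<n∸x⇒x+k<n x k<n∸x)

-- The face

module Face (n : ℕ) (l : List ℕ) where

  rowThreshold : Fin n → ℕ
  rowThreshold i = n ∸ suc (part l (toℕ i))

  penalty : Mat n
  penalty i j = fromℕ (toℕ i ∸ suc (toℕ j)) + fromℕ (toℕ j ∸ rowThreshold i)

  excess : Mat n → ℚ
  excess x = sum (λ j → moment (suc (toℕ j)) (λ i → x i j))
           + sum (λ i → moment (rowThreshold i) (λ j → x i j))

  dot-penalty : ∀ x → dot (λ i j → - penalty i j) x ≡ - excess x
  dot-penalty x = begin
    dot (λ i j → - penalty i j) x
      ≡⟨ dot≡sum (λ i j → - penalty i j) x ⟩
    sum (λ i → sum (λ j → - penalty i j * x i j))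
      ≡⟨ sum-cong-≗ (λ i → sum-cong-≗ (λ j → solve 3 (λ p q y → (:- (p :+ q)) :* y := :- (p :* y :+ q :* y))
                                                      refl (below i j) (beyond i j) (x i j))) ⟩
    sum (λ i → sum (λ j → - (a i j + b i j)))
      ≡⟨ sum-cong-≗ (λ i → sum-neg (λ j → a i j + b i j)) ⟩
    sum (λ i → - sum (λ j → a i j + b i j))
      ≡⟨ sum-neg (λ i → sum (λ j → a i j + b i j)) ⟩
    - sum (λ i → sum (λ j → a i j + b i j))
      ≡⟨ cong -_ (trans (sum-cong-≗ (λ i → ∑-distrib-+ (a i) (b i)))
                        (∑-distrib-+ (λ i → sum (a i)) (λ i → sum (b i)))) ⟩
    - (sum (λ i → sum (a i)) + sum (λ i → sum (b i)))
      ≡⟨ cong (λ s → - (s + sum (λ i → sum (b i)))) (∑-comm a) ⟩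
    - excess x ∎
    where
    open ≡-Reasoning
    open +-*-Solver
    below beyond a b : Fin n → Fin n → ℚ
    below i j = fromℕ (toℕ i ∸ suc (toℕ j))
    beyond i j = fromℕ (toℕ j ∸ rowThreshold i)
    a i j = below i j * x i j
    b i j = beyond i j * x i j

  module _ {x : Mat n} (x∈𝒜 : InASMPolytope n x) where

    column-moment-nonneg : ∀ j → 0ℚ ℚ.≤ moment (suc (toℕ j)) (λ i → x i j)
    column-moment-nonneg j = moment-nonneg (suc (toℕ j)) (λ i → x i j) (ASM-column-SuffixSumsNonneg x∈𝒜 j)

    row-moment-nonneg : ∀ i → 0ℚ ℚ.≤ moment (rowThreshold i) (λ j → x i j)
    row-moment-nonneg i = moment-nonneg (rowThreshold i) (λ j → x i j) (ASM-row-SuffixSumsNonneg x∈𝒜 i)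

    excess-nonneg : 0ℚ ℚ.≤ excess x
    excess-nonneg = ℚP.+-mono-≤ (sum-nonneg column-moment-nonneg) (sum-nonneg row-moment-nonneg)

    excess≡0⇒InPλ : SubStaircase n l → excess x ≡ 0ℚ → InPλ n l x
    excess≡0⇒InPλ ss excess≡0 = x∈𝒜 , belowSubdiagonal≡0 , inShape≡0
      where
      columns≡0×rows≡0 : sum (λ j → moment (suc (toℕ j)) (λ i → x i j)) ≡ 0ℚ
                       × sum (λ i → moment (rowThreshold i) (λ j → x i j)) ≡ 0ℚ
      columns≡0×rows≡0 = nonneg+nonneg≡0 (sum-nonneg column-moment-nonneg) (sum-nonneg row-moment-nonneg) excess≡0
      belowSubdiagonal≡0 : ∀ i j → suc (suc (toℕ j)) ≤ toℕ i → x i j ≡ 0ℚ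
      belowSubdiagonal≡0 i j = moment≡0⇒ (suc (toℕ j)) (λ i → x i j) (ASM-column-SuffixSumsNonneg x∈𝒜 j)
        (sum-nonneg≡0 column-moment-nonneg (proj₁ columns≡0×rows≡0) j) i
      inShape≡0 : ∀ i j → InShape n l i j → x i j ≡ 0ℚ
      inShape≡0 i j inShape = moment≡0⇒ (rowThreshold i) (λ j → x i j) (ASM-row-SuffixSumsNonneg x∈𝒜 i)
        (sum-nonneg≡0 row-moment-nonneg (proj₂ columns≡0×rows≡0) i) j
        (n≤j+p⇒n∸[1+p]<j n (part l (toℕ i)) (toℕ j) (part<n {l = l} ss i) inShape)

  InPλ⇒excess≡0 : ∀ {x} → InPλ n l x → excess x ≡ 0ℚ
  InPλ⇒excess≡0 {x} (_ , belowSubdiagonal≡0 , inShape≡0) = cong₂ _+_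
    (sum-zero (λ j → moment≡0⇐ (suc (toℕ j)) (λ i → x i j) (λ i → belowSubdiagonal≡0 i j)))
    (sum-zero (λ i → moment≡0⇐ (rowThreshold i) (λ j → x i j)
                 (λ j beyond → inShape≡0 i j (n∸[1+p]<j⇒n≤j+p n (part l (toℕ i)) (toℕ j) beyond))))

  Pλ-isFace : SubStaircase n l → IsFace (InPλ n l) (InASMPolytope n)
  Pλ-isFace ss = (λ i j → - penalty i j) , 0ℚ , dot≤0 , λ x → mk⇔ (to x) (from x)
    where
    dot≤0 : ∀ x → InASMPolytope n x → dot (λ i j → - penalty i j) x ℚ.≤ 0ℚ
    dot≤0 x x∈𝒜 = subst (ℚ._≤ 0ℚ) (sym (dot-penalty x)) (ℚP.neg-antimono-≤ (excess-nonneg x∈𝒜))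
    to : ∀ x → InPλ n l x → InASMPolytope n x × dot (λ i j → - penalty i j) x ≡ 0ℚ
    to x x∈Pλ = proj₁ x∈Pλ , trans (dot-penalty x) (cong -_ (InPλ⇒excess≡0 x∈Pλ))
    from : ∀ x → InASMPolytope n x × dot (λ i j → - penalty i j) x ≡ 0ℚ → InPλ n l x
    from x (x∈𝒜 , dot≡0) = excess≡0⇒InPλ x∈𝒜 ss (ℚP.neg-injective (trans (sym (dot-penalty x)) dot≡0))

-- Upper bound on the dimension

bidiagonal-balanced≡0 : ∀ {n} (D : Mat n) →
  (∀ i j → suc (suc (toℕ j)) ≤ toℕ i → D i j ≡ 0ℚ) →
  (∀ i j → toℕ i < toℕ j → D i j ≡ 0ℚ) →
  (∀ i → sum (λ j → D i j) ≡ 0ℚ) →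
  (∀ j → sum (λ i → D i j) ≡ 0ℚ) →
  ∀ i j → D i j ≡ 0ℚ
bidiagonal-balanced≡0 {suc n} D lower upper rows columns = D≡0
  where
  corner≡0 : D zero zero ≡ 0ℚ
  corner≡0 = a+b≡0⇒a≡0 (sum-zero (λ j → upper zero (suc j) (s≤s z≤n))) (rows zero)
  column₀≡0 : ∀ i → D i zero ≡ 0ℚ
  column₀≡0 zero          = corner≡0
  column₀≡0 (suc zero)    = a+b≡0⇒a≡0 (sum-zero (λ i → lower (suc (suc i)) zero (s≤s (s≤s z≤n))))
                                    (a+b≡0⇒b≡0 corner≡0 (columns zero))
  column₀≡0 (suc (suc i)) = lower (suc (suc i)) zero (s≤s (s≤s z≤n))
  minor≡0 : ∀ i j → D (suc i) (suc j) ≡ 0ℚ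
  minor≡0 = bidiagonal-balanced≡0 (λ i j → D (suc i) (suc j))
    (λ i j → lower (suc i) (suc j) ∘ s≤s) (λ i j → upper (suc i) (suc j) ∘ s≤s)
    (λ i → a+b≡0⇒b≡0 (column₀≡0 (suc i)) (rows (suc i)))
    (λ j → a+b≡0⇒b≡0 (upper zero (suc j) (s≤s z≤n)) (columns (suc j)))
  D≡0 : ∀ i j → D i j ≡ 0ℚ
  D≡0 i       zero    = column₀≡0 i
  D≡0 zero    (suc j) = upper zero (suc j) (s≤s z≤n)
  D≡0 (suc i) (suc j) = minor≡0 i j

Pλ-¬affinelyIndependent : ∀ {n l K} (cell : Fin K → Fin n × Fin n) →
  (∀ i j → toℕ i < toℕ j → ¬ InShape n l i j → Σ (Fin K) λ q → cell q ≡ (i , j)) →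
  (p : Fin (suc (suc K)) → Mat n) → (∀ t → InPλ n l (p t)) → ¬ AffinelyIndependent p
Pλ-¬affinelyIndependent {n} {l} {K} cell cell-complete p p∈Pλ indep =
  ¬linearlyIndependent (suc K) augmented augmented-indep
  where
  -- Prepending 1 turns an affine dependence of the free entries into a linear dependence.
  augmented : Fin (suc (suc K)) → Fin (suc K) → ℚ
  augmented t zero    = 1ℚ
  augmented t (suc q) = p t (proj₁ (cell q)) (proj₂ (cell q))
  augmented-indep : LinearlyIndependent augmented
  augmented-indep c dep = indep c Σc≡0 (λ i j → trans (sumF≡sum (λ t → c t * p t i j)) (D≡0 i j))
    where
    Σc≡0 : sumF c ≡ 0ℚ
    Σc≡0 = trans (sumF≡sum c) (trans (sum-cong-≗ (λ t → sym (ℚP.*-identityʳ (c t)))) (dep zero))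
    D : Mat n
    D i j = sum (λ t → c t * p t i j)
    D≡0-where-all≡0 : ∀ i j → (∀ t → p t i j ≡ 0ℚ) → D i j ≡ 0ℚ
    D≡0-where-all≡0 i j p≡0 = sum-zero (λ t → trans (cong (c t *_) (p≡0 t)) (ℚP.*-zeroʳ (c t)))
    upper : ∀ i j → toℕ i < toℕ j → D i j ≡ 0ℚ
    upper i j i<j with n ℕP.≤? toℕ j ℕ.+ part l (toℕ i)
    ... | yes inShape = D≡0-where-all≡0 i j (λ t → proj₂ (proj₂ (p∈Pλ t)) i j inShape)
    ... | no  ¬inShape with cell-complete i j i<j ¬inShape
    ...   | q , cell≡ij = subst (λ ij → D (proj₁ ij) (proj₂ ij) ≡ 0ℚ) cell≡ij (dep (suc q))
    D≡0 : ∀ i j → D i j ≡ 0ℚ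
    D≡0 = bidiagonal-balanced≡0 D
      (λ i j below → D≡0-where-all≡0 i j (λ t → proj₁ (proj₂ (p∈Pλ t)) i j below))
      upper
      (λ i → trans (sum-combination c (λ t j → p t i j) (λ t → rowSum (p∈Pλ t) i)) (dep zero))
      (λ j → trans (sum-combination c (λ t i → p t i j) (λ t → columnSum (p∈Pλ t) j)) (dep zero))
      where
      rowSum : ∀ {x} → InPλ n l x → ∀ i → sumF (λ j → x i j) ≡ 1ℚ
      rowSum ((_ , _ , _ , rowSums) , _) = rowSums
      columnSum : ∀ {x} → InPλ n l x → ∀ j → sumF (λ i → x i j) ≡ 1ℚ
      columnSum ((_ , _ , columnSums , _) , _) = columnSums

-- Permutation matrices

δ : ℕ → ℕ → ℚ
δ zero    zero    = 1ℚ
δ zero    (suc b) = 0ℚ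
δ (suc a) zero    = 0ℚ
δ (suc a) (suc b) = δ a b

δ-refl : ∀ a → δ a a ≡ 1ℚ
δ-refl zero    = refl
δ-refl (suc a) = δ-refl a

δ-≢ : ∀ {a b} → a ≢ b → δ a b ≡ 0ℚ
δ-≢ {zero}  {zero}  a≢b = ⊥-elim (a≢b refl)
δ-≢ {zero}  {suc b} _   = refl
δ-≢ {suc a} {zero}  _   = refl
δ-≢ {suc a} {suc b} a≢b = δ-≢ (a≢b ∘ cong suc)

δ-transpose : ∀ {σ τ : ℕ → ℕ} → (∀ i → τ (σ i) ≡ i) → (∀ j → σ (τ j) ≡ j) →
              ∀ i j → δ (σ i) j ≡ δ (τ j) i
δ-transpose {σ} {τ} τσ στ i j with σ i ℕP.≟ j
... | yes refl = trans (δ-refl (σ i)) (sym (trans (cong (λ k → δ k i) (τσ i)) (δ-refl i)))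
... | no  σi≢j = trans (δ-≢ σi≢j) (sym (δ-≢ (λ τj≡i → σi≢j (trans (cong σ (sym τj≡i)) (στ j)))))

psum-cong : ∀ {n} {f g : Fin n → ℚ} → (∀ i → f i ≡ g i) → ∀ m → psum f m ≡ psum g m
psum-cong {zero}  f≗g m       = refl
psum-cong {suc n} f≗g zero    = refl
psum-cong {suc n} f≗g (suc m) = cong₂ _+_ (f≗g zero) (psum-cong (f≗g ∘ suc) m)

psum-zeros : ∀ {n} m → psum {n} (λ _ → 0ℚ) m ≡ 0ℚ
psum-zeros {zero}  m       = refl
psum-zeros {suc n} zero    = refl
psum-zeros {suc n} (suc m) = trans (ℚP.+-identityˡ (psum {n} (λ _ → 0ℚ) m)) (psum-zeros {n} m)

δ-psum-bounds : ∀ {n} a m → 0ℚ ℚ.≤ psum {n} (δ a ∘ toℕ) m × psum {n} (δ a ∘ toℕ) m ℚ.≤ 1ℚ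
δ-psum-bounds {zero}  a       m       = ℚP.≤-refl , 0≤1
δ-psum-bounds {suc n} a       zero    = ℚP.≤-refl , 0≤1
δ-psum-bounds {suc n} zero    (suc m) rewrite psum-zeros {n} m = 0≤1 , ℚP.≤-refl
δ-psum-bounds {suc n} (suc a) (suc m) rewrite ℚP.+-identityˡ (psum {n} (δ a ∘ toℕ) m) =
  δ-psum-bounds {n} a m

δ-sum : ∀ {n} a → a < n → sumF {n} (δ a ∘ toℕ) ≡ 1ℚ
δ-sum {suc n} zero    _         = cong (1ℚ +_) (psum-zeros {n} n)
δ-sum {suc n} (suc a) (s≤s a<n) = trans (ℚP.+-identityˡ (sumF {n} (δ a ∘ toℕ))) (δ-sum a a<n)

permutationMatrix : ∀ {n} → (ℕ → ℕ) → Mat n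
permutationMatrix σ i j = δ (σ (toℕ i)) (toℕ j)

permutationMatrix∈𝒜 : ∀ {n} (σ τ : ℕ → ℕ) → (∀ i → τ (σ i) ≡ i) → (∀ j → σ (τ j) ≡ j) →
                      (∀ i → i < n → σ i < n) → (∀ j → j < n → τ j < n) →
                      InASMPolytope n (permutationMatrix σ)
permutationMatrix∈𝒜 {n} σ τ τσ στ σ<n τ<n =
    (λ j m _ _ → subst (λ s → 0ℚ ℚ.≤ s × s ℚ.≤ 1ℚ) (sym (psum-cong (column j) m))
                       (δ-psum-bounds {n} (τ (toℕ j)) m))
  , (λ i m _ _ → δ-psum-bounds {n} (σ (toℕ i)) m)
  , (λ j → trans (psum-cong (column j) n) (δ-sum (τ (toℕ j)) (τ<n _ (FinP.toℕ<n j))))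
  , (λ i → δ-sum (σ (toℕ i)) (σ<n _ (FinP.toℕ<n i)))
  where
  column : ∀ j i → permutationMatrix σ i j ≡ δ (τ (toℕ j)) (toℕ i)
  column j i = δ-transpose {σ} {τ} τσ στ (toℕ i) (toℕ j)

permutationMatrix-≢ : ∀ {n} σ (i j : Fin n) → toℕ j ≢ σ (toℕ i) → permutationMatrix σ i j ≡ 0ℚ
permutationMatrix-≢ σ i j j≢σi = δ-≢ (j≢σi ∘ sym)

permutationMatrix∈Pλ : ∀ {n l} (σ τ : ℕ → ℕ) → (∀ i → τ (σ i) ≡ i) → (∀ j → σ (τ j) ≡ j) →
  (∀ i → i < n → σ i < n) → (∀ j → j < n → τ j < n) →
  (∀ i → i ≤ suc (σ i)) → (∀ (i : Fin n) → σ (toℕ i) ℕ.+ part l (toℕ i) < n) →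
  InPλ n l (permutationMatrix σ)
permutationMatrix∈Pλ {n} {l} σ τ τσ στ σ<n τ<n i≤1+σi σ+part<n =
    permutationMatrix∈𝒜 σ τ τσ στ σ<n τ<n
  , (λ i j 2+j≤i → permutationMatrix-≢ σ i j λ j≡σi →
       ℕP.<⇒≱ 2+j≤i (subst (λ k → toℕ i ≤ suc k) (sym j≡σi) (i≤1+σi (toℕ i))))
  , (λ i j inShape → permutationMatrix-≢ σ i j λ j≡σi →
       ℕP.<⇒≱ (σ+part<n i) (subst (λ k → n ≤ k ℕ.+ part l (toℕ i)) j≡σi inShape))

module Cycle (r c : ℕ) (r<c : r < c) where

  σ : ℕ → ℕ
  σ i with ℕP.<-cmp i r
  ... | tri< _ _ _ = i
  ... | tri≈ _ _ _ = c
  ... | tri> _ _ _ with i ℕP.≤? c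
  ...   | yes _ = ℕ.pred i
  ...   | no  _ = i

  τ : ℕ → ℕ
  τ j with ℕP.<-cmp j c
  ... | tri> _ _ _ = j
  ... | tri≈ _ _ _ = r
  ... | tri< _ _ _ with r ℕP.≤? j
  ...   | yes _ = suc j
  ...   | no  _ = j

  σ-before : ∀ i → i < r → σ i ≡ i
  σ-before i i<r with ℕP.<-cmp i r
  ... | tri< _ _ _   = refl
  ... | tri≈ i≮r _ _ = ⊥-elim (i≮r i<r)
  ... | tri> i≮r _ _ = ⊥-elim (i≮r i<r)

  σ-at : σ r ≡ c
  σ-at with ℕP.<-cmp r r
  ... | tri< _ r≢r _ = ⊥-elim (r≢r refl)
  ... | tri≈ _ _ _   = refl
  ... | tri> _ r≢r _ = ⊥-elim (r≢r refl)

  σ-inside : ∀ i → r < i → i ≤ c → σ i ≡ ℕ.pred i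
  σ-inside i r<i i≤c with ℕP.<-cmp i r
  ... | tri< _ _ i≯r = ⊥-elim (i≯r r<i)
  ... | tri≈ _ _ i≯r = ⊥-elim (i≯r r<i)
  ... | tri> _ _ _ with i ℕP.≤? c
  ...   | yes _   = refl
  ...   | no  i≰c = ⊥-elim (i≰c i≤c)

  σ-after : ∀ i → c < i → σ i ≡ i
  σ-after i c<i with ℕP.<-cmp i r
  ... | tri< i<r _ _ = ⊥-elim (ℕP.<-asym (ℕP.<-trans i<r r<c) c<i)
  ... | tri≈ _ i≡r _ = ⊥-elim (ℕP.<-asym r<c (subst (c <_) i≡r c<i))
  ... | tri> _ _ _ with i ℕP.≤? c
  ...   | yes i≤c = ⊥-elim (ℕP.<⇒≱ c<i i≤c)
  ...   | no  _   = refl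

  τ-before : ∀ j → j < r → τ j ≡ j
  τ-before j j<r with ℕP.<-cmp j c
  ... | tri> _ _ j>c = ⊥-elim (ℕP.<-asym (ℕP.<-trans j<r r<c) j>c)
  ... | tri≈ _ j≡c _ = ⊥-elim (ℕP.<-asym r<c (subst (_< r) j≡c j<r))
  ... | tri< _ _ _ with r ℕP.≤? j
  ...   | yes r≤j = ⊥-elim (ℕP.<⇒≱ j<r r≤j)
  ...   | no  _   = refl

  τ-inside : ∀ j → r ≤ j → j < c → τ j ≡ suc j
  τ-inside j r≤j j<c with ℕP.<-cmp j c
  ... | tri> j≮c _ _ = ⊥-elim (j≮c j<c)
  ... | tri≈ j≮c _ _ = ⊥-elim (j≮c j<c)
  ... | tri< _ _ _ with r ℕP.≤? j
  ...   | yes _   = refl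
  ...   | no  r≰j = ⊥-elim (r≰j r≤j)

  τ-at : τ c ≡ r
  τ-at with ℕP.<-cmp c c
  ... | tri< _ c≢c _ = ⊥-elim (c≢c refl)
  ... | tri≈ _ _ _   = refl
  ... | tri> _ c≢c _ = ⊥-elim (c≢c refl)

  τ-after : ∀ j → c < j → τ j ≡ j
  τ-after j c<j with ℕP.<-cmp j c
  ... | tri> _ _ _   = refl
  ... | tri≈ _ _ j≯c = ⊥-elim (j≯c c<j)
  ... | tri< _ _ j≯c = ⊥-elim (j≯c c<j)

  data RowRegion (i : ℕ) : Set where
    before : i < r → RowRegion i
    at     : i ≡ r → RowRegion i
    inside : r < i → i ≤ c → RowRegion i
    after  : c < i → RowRegion i

  rowRegion : ∀ i → RowRegion i
  rowRegion i with ℕP.<-cmp i r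
  ... | tri< i<r _ _ = before i<r
  ... | tri≈ _ i≡r _ = at i≡r
  ... | tri> _ _ r<i with i ℕP.≤? c
  ...   | yes i≤c = inside r<i i≤c
  ...   | no  i≰c = after (ℕP.≰⇒> i≰c)

  data ColumnRegion (j : ℕ) : Set where
    before : j < r → ColumnRegion j
    inside : r ≤ j → j < c → ColumnRegion j
    at     : j ≡ c → ColumnRegion j
    after  : c < j → ColumnRegion j

  columnRegion : ∀ j → ColumnRegion j
  columnRegion j with ℕP.<-cmp j c
  ... | tri> _ _ c<j = after c<j
  ... | tri≈ _ j≡c _ = at j≡c
  ... | tri< j<c _ _ with r ℕP.≤? j
  ...   | yes r≤j = inside r≤j j<c
  ...   | no  r≰j = before (ℕP.≰⇒> r≰j)

  τσ : ∀ i → τ (σ i) ≡ i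
  τσ i with rowRegion i
  ... | before i<r        = trans (cong τ (σ-before i i<r)) (τ-before i i<r)
  ... | at refl           = trans (cong τ σ-at) τ-at
  ... | inside r<i i≤c    = trans (cong τ (σ-inside i r<i i≤c)) (τ-pred i r<i i≤c)
    where
    τ-pred : ∀ i → r < i → i ≤ c → τ (ℕ.pred i) ≡ i
    τ-pred (suc i) (s≤s r≤i) i<c = τ-inside i r≤i i<c
  ... | after c<i         = trans (cong τ (σ-after i c<i)) (τ-after i c<i)

  στ : ∀ j → σ (τ j) ≡ j
  στ j with columnRegion j
  ... | before j<r     = trans (cong σ (τ-before j j<r)) (σ-before j j<r)
  ... | inside r≤j j<c = trans (cong σ (τ-inside j r≤j j<c)) (σ-inside (suc j) (s≤s r≤j) j<c)
  ... | at refl        = trans (cong σ τ-at) σ-at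
  ... | after c<j      = trans (cong σ (τ-after j c<j)) (σ-after j c<j)

  σ<n : ∀ {n} → c < n → ∀ i → i < n → σ i < n
  σ<n c<n i i<n with rowRegion i
  ... | before i<r     = subst (_< _) (sym (σ-before i i<r)) i<n
  ... | at refl        = subst (_< _) (sym σ-at) c<n
  ... | inside r<i i≤c = subst (_< _) (sym (σ-inside i r<i i≤c)) (ℕP.≤-<-trans ℕP.pred[n]≤n i<n)
  ... | after c<i      = subst (_< _) (sym (σ-after i c<i)) i<n

  τ<n : ∀ {n} → c < n → ∀ j → j < n → τ j < n
  τ<n c<n j j<n with columnRegion j
  ... | before j<r     = subst (_< _) (sym (τ-before j j<r)) j<n
  ... | inside r≤j j<c = subst (_< _) (sym (τ-inside j r≤j j<c)) (ℕP.<-≤-trans (s≤s j<c) c<n)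
  ... | at refl        = subst (_< _) (sym τ-at) (ℕP.<-trans r<c c<n)
  ... | after c<j      = subst (_< _) (sym (τ-after j c<j)) j<n

  i≤1+σi : ∀ i → i ≤ suc (σ i)
  i≤1+σi i with rowRegion i
  ... | before i<r     = subst (λ k → i ≤ suc k) (sym (σ-before i i<r)) (ℕP.n≤1+n i)
  ... | at refl        = subst (λ k → i ≤ suc k) (sym σ-at) (ℕP.≤-trans (ℕP.<⇒≤ r<c) (ℕP.n≤1+n c))
  ... | inside r<i i≤c = subst (λ k → i ≤ suc k) (sym (σ-inside i r<i i≤c))
                               (ℕP.≤-reflexive (sym (ℕP.suc-pred i {{ℕ.>-nonZero (ℕP.≤-<-trans z≤n r<i)}})))
  ... | after c<i      = subst (λ k → i ≤ suc k) (sym (σ-after i c<i)) (ℕP.n≤1+n i)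

  σi≤i : ∀ i → i ≢ r → σ i ≤ i
  σi≤i i i≢r with rowRegion i
  ... | before i<r     = ℕP.≤-reflexive (σ-before i i<r)
  ... | at i≡r         = ⊥-elim (i≢r i≡r)
  ... | inside r<i i≤c = ℕP.≤-trans (ℕP.≤-reflexive (σ-inside i r<i i≤c)) ℕP.pred[n]≤n
  ... | after c<i      = ℕP.≤-reflexive (σ-after i c<i)

flatten : ∀ {n} (m : Fin n → ℕ) → Σ (Fin n) (Fin ∘ m) → Fin (ℕ∑.sum m)
flatten m (zero  , k) = k ↑ˡ ℕ∑.sum (tail m)
flatten m (suc r , k) = m zero ↑ʳ flatten (tail m) (r , k)

unflatten : ∀ {n} (m : Fin n → ℕ) → Fin (ℕ∑.sum m) → Σ (Fin n) (Fin ∘ m)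
unflatten {suc n} m q = [ (zero ,_) , Product.map suc id ∘ unflatten (tail m) ]′ (splitAt (m zero) q)

unflatten-flatten : ∀ {n} (m : Fin n → ℕ) x → unflatten m (flatten m x) ≡ x
unflatten-flatten m (zero  , k) rewrite FinP.splitAt-↑ˡ (m zero) k (ℕ∑.sum (tail m)) = refl
unflatten-flatten m (suc r , k) rewrite FinP.splitAt-↑ʳ (m zero) (ℕ∑.sum (tail m)) (flatten (tail m) (r , k))
  = cong (Product.map suc id) (unflatten-flatten (tail m) (r , k))

flatten-unflatten : ∀ {n} (m : Fin n → ℕ) q → flatten m (unflatten m q) ≡ q
flatten-unflatten {suc n} m q with splitAt (m zero) q in split≡
... | inj₁ k  = FinP.splitAt⁻¹-↑ˡ split≡
... | inj₂ q′ = trans (cong (m zero ↑ʳ_) (flatten-unflatten (tail m) q′)) (FinP.splitAt⁻¹-↑ʳ split≡)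

sum-part : ∀ {n} l → length l ≤ n → ℕ∑.sum {n} (part l ∘ toℕ) ≡ size l
sum-part {zero}  []      _           = refl
sum-part {suc n} []      _           = sum-part {n} [] z≤n
sum-part {suc n} (x ∷ l) (s≤s len≤n) = cong (x ℕ.+_) (sum-part l len≤n)

sum-triangle : ∀ n → ℕ∑.sum {n} (λ r → n ∸ suc (toℕ r)) ≡ n C 2
sum-triangle zero    = refl
sum-triangle (suc n) = begin
  n ℕ.+ ℕ∑.sum {n} (λ r → n ∸ suc (toℕ r)) ≡⟨ cong (n ℕ.+_) (sum-triangle n) ⟩
  n ℕ.+ n C 2                              ≡⟨ cong (ℕ._+ n C 2) (nC1≡n n) ⟨
  n C 1 ℕ.+ n C 2                          ≡⟨ nCk+nC[k+1]≡[n+1]C[k+1] n 1 ⟩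
  suc n C 2                                ∎
  where open ≡-Reasoning

module FreeCells (n : ℕ) (l : List ℕ) (ss : SubStaircase n l) where

  -- The free cells of row r are (r, r + 1 + k) for k < width r.
  width : Fin n → ℕ
  width r = n ∸ suc (toℕ r) ∸ part l (toℕ r)

  K : ℕ
  K = ℕ∑.sum width

  private
    beyond-column<n : ∀ r (k : Fin (width r)) → suc (toℕ r) ℕ.+ (part l (toℕ r) ℕ.+ toℕ k) < n
    beyond-column<n r k = k<n∸x⇒x+k<n (suc (toℕ r)) (k<n∸x⇒x+k<n (part l (toℕ r)) (FinP.toℕ<n k))

  column : ∀ r → Fin (width r) → Fin n
  column r k = fromℕ< (ℕP.≤-<-trans (s≤s (ℕP.+-monoʳ-≤ (toℕ r) (ℕP.m≤n+m (toℕ k) _)))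
                                    (beyond-column<n r k))

  toℕ-column : ∀ r k → toℕ (column r k) ≡ suc (toℕ r ℕ.+ toℕ k)
  toℕ-column r k = FinP.toℕ-fromℕ< _

  column-free : ∀ r k → toℕ r < toℕ (column r k) × toℕ (column r k) ℕ.+ part l (toℕ r) < n
  column-free r k rewrite toℕ-column r k =
    s≤s (ℕP.m≤m+n (toℕ r) (toℕ k)) ,
    subst (_< n) (sym (rearrange (toℕ r) (toℕ k) (part l (toℕ r)))) (beyond-column<n r k)
    where
    rearrange : ∀ r k p → suc (r ℕ.+ k) ℕ.+ p ≡ suc r ℕ.+ (p ℕ.+ k)
    rearrange = solve-∀

  toCell : Σ (Fin n) (Fin ∘ width) → Fin n × Fin n
  toCell (r , k) = r , column r k

  cell : Fin K → Fin n × Fin n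
  cell = toCell ∘ unflatten width

  toCell-injective : ∀ x y → toCell x ≡ toCell y → x ≡ y
  toCell-injective (r , k) (r′ , k′) cells≡ with cong proj₁ cells≡
  ... | refl = cong (r ,_) (FinP.toℕ-injective (ℕP.+-cancelˡ-≡ (toℕ r) (toℕ k) (toℕ k′) (ℕP.suc-injective
                 (trans (sym (toℕ-column r k)) (trans (cong (toℕ ∘ proj₂) cells≡) (toℕ-column r k′))))))

  cell-injective : ∀ q q′ → cell q ≡ cell q′ → q ≡ q′
  cell-injective q q′ cells≡ = begin
    q                                  ≡⟨ flatten-unflatten width q ⟨
    flatten width (unflatten width q)  ≡⟨ cong (flatten width) (toCell-injective _ _ cells≡) ⟩
    flatten width (unflatten width q′) ≡⟨ flatten-unflatten width q′ ⟩
    q′                                 ∎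
    where open ≡-Reasoning

  cell-complete : ∀ i j → toℕ i < toℕ j → ¬ InShape n l i j → Σ (Fin K) λ q → cell q ≡ (i , j)
  cell-complete i j i<j ¬inShape = flatten width (i , k) , (begin
    toCell (unflatten width (flatten width (i , k)))  ≡⟨ cong toCell (unflatten-flatten width (i , k)) ⟩
    i , column i k                                     ≡⟨ cong (i ,_) (FinP.toℕ-injective toℕ-column≡j) ⟩
    i , j                                              ∎)
    where
    open ≡-Reasoning
    p d : ℕ
    p = part l (toℕ i)
    d = toℕ j ∸ suc (toℕ i)
    d+1+i≡j : d ℕ.+ suc (toℕ i) ≡ toℕ j
    d+1+i≡j = ℕP.m∸n+n≡m i<j
    d<width : d < width i
    d<width = ℕP.m+n≤o⇒m≤o∸n (suc d) (ℕP.m+n≤o⇒m≤o∸n (suc d ℕ.+ p)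
                (subst (_< n) (trans (cong (ℕ._+ p) (sym d+1+i≡j)) (+-right-comm d (suc (toℕ i)) p))
                       (ℕP.≰⇒> ¬inShape)))
      where
      +-right-comm : ∀ a b c → a ℕ.+ b ℕ.+ c ≡ a ℕ.+ c ℕ.+ b
      +-right-comm = solve-∀
    k : Fin (width i)
    k = fromℕ< d<width
    toℕ-column≡j : toℕ (column i k) ≡ toℕ j
    toℕ-column≡j = begin
      toℕ (column i k)           ≡⟨ toℕ-column i k ⟩
      suc (toℕ i ℕ.+ toℕ k)      ≡⟨ cong (λ x → suc (toℕ i ℕ.+ x)) (FinP.toℕ-fromℕ< d<width) ⟩
      suc (toℕ i) ℕ.+ d          ≡⟨ ℕP.+-comm (suc (toℕ i)) d ⟩
      d ℕ.+ suc (toℕ i)          ≡⟨ d+1+i≡j ⟩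
      toℕ j                      ∎

  K+size≡nC2 : K ℕ.+ size l ≡ n C 2
  K+size≡nC2 = begin
    K ℕ.+ size l                               ≡⟨ cong (K ℕ.+_) (sum-part {n} l (SubStaircase⇒length≤ {l = l} ss)) ⟨
    K ℕ.+ ℕ∑.sum {n} (part l ∘ toℕ)            ≡⟨ ℕ∑.∑-distrib-+ width (λ r → part l (toℕ r)) ⟨
    ℕ∑.sum (λ r → width r ℕ.+ part l (toℕ r))  ≡⟨ ℕ∑.sum-cong-≗ {n} width+part≡ ⟩
    ℕ∑.sum {n} (λ r → n ∸ suc (toℕ r))         ≡⟨ sum-triangle n ⟩
    n C 2                                      ∎
    where
    open ≡-Reasoning
    width+part≡ : ∀ r → width r ℕ.+ part l (toℕ r) ≡ n ∸ suc (toℕ r)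
    width+part≡ r = ℕP.m∸n+n≡m (ℕP.m+n≤o⇒m≤o∸n (part l (toℕ r))
                                  (SubStaircase-bound {l = l} ss (toℕ r) (FinP.toℕ<n r)))

  K≡nC2∸size : K ≡ n C 2 ∸ size l
  K≡nC2∸size = trans (sym (ℕP.m+n∸n≡m K (size l))) (cong (_∸ size l) K+size≡nC2)

  cell-free : ∀ q → toℕ (proj₁ (cell q)) < toℕ (proj₂ (cell q))
                  × toℕ (proj₂ (cell q)) ℕ.+ part l (toℕ (proj₁ (cell q))) < n
  cell-free q = column-free (proj₁ (unflatten width q)) (proj₂ (unflatten width q))

-- Lower bound on the dimension

privateCells⇒affinelyIndependent : ∀ {n K} (p : Fin (suc K) → Mat n) (cell : Fin K → Fin n × Fin n) →
  (∀ q → p (suc q) (proj₁ (cell q)) (proj₂ (cell q)) ≡ 1ℚ) →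
  (∀ q t → t ≢ suc q → p t (proj₁ (cell q)) (proj₂ (cell q)) ≡ 0ℚ) →
  AffinelyIndependent p
privateCells⇒affinelyIndependent {n} p cell owner≡1 others≡0 c Σc≡0 combination≡0 = c≡0
  where
  c-suc≡0 : ∀ q → c (suc q) ≡ 0ℚ
  c-suc≡0 q = begin
    c (suc q)                             ≡⟨ ℚP.*-identityʳ (c (suc q)) ⟨
    c (suc q) * 1ℚ                        ≡⟨ cong (c (suc q) *_) (owner≡1 q) ⟨
    c (suc q) * p (suc q) i j             ≡⟨ sum-single (suc q) (λ t → c t * p t i j) others-term≡0 ⟨
    sum (λ t → c t * p t i j)             ≡⟨ sumF≡sum (λ t → c t * p t i j) ⟨
    sumF (λ t → c t * p t i j)            ≡⟨ combination≡0 i j ⟩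
    0ℚ                                    ∎
    where
    open ≡-Reasoning
    i j : Fin n
    i = proj₁ (cell q)
    j = proj₂ (cell q)
    others-term≡0 : ∀ t → t ≢ suc q → c t * p t i j ≡ 0ℚ
    others-term≡0 t t≢q = trans (cong (c t *_) (others≡0 q t t≢q)) (ℚP.*-zeroʳ (c t))
  c≡0 : ∀ t → c t ≡ 0ℚ
  c≡0 zero    = a+b≡0⇒a≡0 (sum-zero c-suc≡0) (trans (sym (sumF≡sum c)) Σc≡0)
  c≡0 (suc q) = c-suc≡0 q

module Vertices (n : ℕ) (l : List ℕ) (ss : SubStaircase n l) where
  open FreeCells n l ss

  identity∈Pλ : InPλ n l (permutationMatrix id)
  identity∈Pλ = permutationMatrix∈Pλ {l = l} id id (λ _ → refl) (λ _ → refl) (λ _ i<n → i<n) (λ _ j<n → j<n)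
                                              ℕP.n≤1+n (diagonal+part<n {n} {l} ss)

  module _ (q : Fin K) where
    r c : ℕ
    r = toℕ (proj₁ (cell q))
    c = toℕ (proj₂ (cell q))

    r<c : r < c
    r<c = proj₁ (cell-free q)

    open Cycle r c r<c public

    cycle∈Pλ : InPλ n l (permutationMatrix σ)
    cycle∈Pλ = permutationMatrix∈Pλ {l = l} σ τ τσ στ (σ<n c<n) (τ<n c<n) i≤1+σi σ+part<n
      where
      c<n : c < n
      c<n = FinP.toℕ<n (proj₂ (cell q))
      σ+part<n : ∀ (i : Fin n) → σ (toℕ i) ℕ.+ part l (toℕ i) < n
      σ+part<n i = bound (toℕ i ℕP.≟ r)
        where
        bound : Dec (toℕ i ≡ r) → σ (toℕ i) ℕ.+ part l (toℕ i) < n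
        bound (yes i≡r) = subst (λ k → σ k ℕ.+ part l k < n) (sym i≡r)
                                (subst (λ k → k ℕ.+ part l r < n) (sym σ-at) (proj₂ (cell-free q)))
        bound (no  i≢r) = ℕP.≤-<-trans (ℕP.+-monoˡ-≤ (part l (toℕ i)) (σi≤i (toℕ i) i≢r))
                                       (diagonal+part<n {n} {l} ss i)

  vertex : Fin (suc K) → Mat n
  vertex zero    = permutationMatrix id
  vertex (suc q) = permutationMatrix (σ q)

  vertex∈Pλ : ∀ t → InPλ n l (vertex t)
  vertex∈Pλ zero    = identity∈Pλ
  vertex∈Pλ (suc q) = cycle∈Pλ q

  vertex-owner≡1 : ∀ q → vertex (suc q) (proj₁ (cell q)) (proj₂ (cell q)) ≡ 1ℚ
  vertex-owner≡1 q = subst (λ k → δ k (c q) ≡ 1ℚ) (sym (σ-at q)) (δ-refl (c q))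

  vertex-others≡0 : ∀ q t → t ≢ suc q → vertex t (proj₁ (cell q)) (proj₂ (cell q)) ≡ 0ℚ
  vertex-others≡0 q zero     _    = δ-≢ (ℕP.<⇒≢ (r<c q))
  vertex-others≡0 q (suc q′) q′≢q = δ-≢ (σ′r≢c (r q ℕP.≟ r q′))
    where
    σ′r≢c : Dec (r q ≡ r q′) → σ q′ (r q) ≢ c q
    σ′r≢c (yes r≡r′) σ′r≡c = q′≢q (cong suc (cell-injective q′ q (×-≡,≡→≡
      (FinP.toℕ-injective (sym r≡r′) ,
       FinP.toℕ-injective (trans (sym (σ-at q′)) (trans (cong (σ q′) (sym r≡r′)) σ′r≡c))))))
    σ′r≢c (no  r≢r′) = ℕP.<⇒≢ (ℕP.≤-<-trans (σi≤i q′ (r q) r≢r′) (r<c q))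

  vertex-affinelyIndependent : AffinelyIndependent vertex
  vertex-affinelyIndependent =
    privateCells⇒affinelyIndependent vertex cell vertex-owner≡1 vertex-others≡0

theorem4p3 : ∀ (n : ℕ) → 1 ≤ n → (l : List ℕ) → IsPartition l → SubStaircase n l →
    IsFace (InPλ n l) (InASMPolytope n) × HasDimension (InPλ n l) (n C 2 ∸ size l)
theorem4p3 n _ l _ ss = Face.Pλ-isFace n l ss ,
  subst (HasDimension (InPλ n l)) K≡nC2∸size
    ( (vertex , vertex∈Pλ , vertex-affinelyIndependent)
    , λ (p , p∈Pλ , p-indep) → Pλ-¬affinelyIndependent {l = l} cell cell-complete p p∈Pλ p-indep)
  where
  open FreeCells n l ss
  open Vertices n l ss
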